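{- Let $G$ be a finite simple graph of order $n$ and let $H$ be a finite simple graph with root vertex $v$. Then $$\rho(G\circ_v H)=\begin{cases}\rho(G)+n(\rho(H)-1), & \text{if } v\in P_H \text{ for every } \rho(H)\text{ -set } P_H,\\ n\rho(H), & \text{if } v\notin P_H \text{ for some } \rho(H)\text{ -set } P_H.\end{cases}$$
   Context: A packing of a graph $G$ is a set $P\subseteq V(G)$ with $N_G[u]\cap N_G[v]=\emptyset$ for distinct $u,v\in P$ (closed neighborhoods); $\rho(G)$ is the maximum size of a packing, and a $\rho(G)$-set is a packing of size $\rho(G)$. For $V(G)=\{g_1,\dots,g_n\}$ and a graph $H$ with a distinguished vertex (root) $v$, the rooted product graph $G\circ_v H$ has vertex set $V(G)\times V(H)$ and edge set $\bigcup_{i=1}^n\{(g_i,h)(g_i,h'): hh'\in E(H)\}\cup\{(g_i,v)(g_j,v): g_ig_j\in E(G)\}$; equivalently, it is obtained from $G$ by attaching a copy of $H$ to each vertex of $G$, identifying that vertex with the root of the copy. -}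

module Defs where

open import Data.Nat using (ℕ; _*_)
open import Data.Fin using (Fin; remQuot)
open import Data.Fin.Subset using (Subset; _∈_; ∣_∣)
open import Data.Product using (_×_; _,_; proj₁; proj₂; ∃-syntax)
open import Data.Sum using (_⊎_; inj₁; inj₂)
open import Relation.Binary.PropositionalEquality using (_≡_; _≢_; sym; subst)
open import Relation.Nullary using (¬_)
open import Data.Nat using (_≤_)

record Graph (n : ℕ) : Set₁ where
  field
    Adj    : Fin n → Fin n → Set
    adj-sym : ∀ {x y} → Adj x y → Adj y x
    adj-irrefl : ∀ {x} → ¬ Adj x x
open Graph public

InClosedNbhd : ∀ {n} → Graph n → Fin n → Fin n → Set
InClosedNbhd G u w = (w ≡ u) ⊎ Adj G u w

IsPacking : ∀ {n} → Graph n → Subset n → Set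
IsPacking G P = ∀ u v → u ∈ P → v ∈ P → u ≢ v →
  ∀ w → ¬ (InClosedNbhd G u w × InClosedNbhd G v w)

IsPackingNumber : ∀ {n} → Graph n → ℕ → Set
IsPackingNumber G k =
  (∃[ P ] (IsPacking G P × ∣ P ∣ ≡ k)) × (∀ P → IsPacking G P → ∣ P ∣ ≤ k)

IsRhoSet : ∀ {n} → Graph n → Subset n → Set
IsRhoSet G P = IsPacking G P × (∀ Q → IsPacking G Q → ∣ Q ∣ ≤ ∣ P ∣)

-- Rooted product G ∘_v H.  Vertex (g_i , h) is encoded as
-- combine i h : Fin (n * m), decoded with remQuot.
RPAdj : ∀ {n m} → Graph n → Graph m → Fin m → Fin (n * m) → Fin (n * m) → Set
RPAdj {n} {m} G H v x y with remQuot {n} m x | remQuot {n} m y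
... | (i , h) | (j , h') = ((i ≡ j) × Adj H h h') ⊎ ((h ≡ v) × (h' ≡ v) × Adj G i j)

private
  rp-sym : ∀ {n m} (G : Graph n) (H : Graph m) (v : Fin m) {x y} →
           RPAdj G H v x y → RPAdj G H v y x
  rp-sym {n} {m} G H v {x} {y} a with remQuot {n} m x | remQuot {n} m y
  ... | (i , h) | (j , h') with a
  ... | inj₁ (e , b) = inj₁ (sym e , Graph.adj-sym H b)
  ... | inj₂ (e , e' , b) = inj₂ (e' , e , Graph.adj-sym G b)

  rp-irrefl : ∀ {n m} (G : Graph n) (H : Graph m) (v : Fin m) {x} →
              ¬ RPAdj G H v x x
  rp-irrefl {n} {m} G H v {x} a with remQuot {n} m x
  ... | (i , h) with a
  ... | inj₁ (_ , b) = Graph.adj-irrefl H b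
  ... | inj₂ (_ , _ , b) = Graph.adj-irrefl G b

RootedProduct : ∀ {n m} → Graph n → Graph m → Fin m → Graph (n * m)
RootedProduct G H v = record
  { Adj = RPAdj G H v ; adj-sym = rp-sym G H v ; adj-irrefl = rp-irrefl G H v }

-- A packing of G ∘ H splits into its blocks, one packing of H in each copy, and a
-- closed neighbourhood of G ∘ H leaves its copy only through the root layer, where it
-- is the closed neighbourhood of G. So a packing of G ∘ H is exactly a choice of a
-- packing of H in every copy such that the copies whose block contains the root v form
-- a packing of G, and no block of a neighbouring copy comes within distance one of v.
-- If some ρ(H)-set avoids v, it can be used in every copy, while no block exceeds ρ(H):
-- this gives n ρ(H). If every ρ(H)-set contains v, a block without v has at most
-- ρ(H) - 1 vertices, so at most ρ(G) blocks reach ρ(H); conversely P - v in every copy,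
-- upgraded to P in the copies of a ρ(G)-set, is a packing: this gives ρ(G) + n(ρ(H) - 1).
module Submission where

open import Defs
open import Algebra.Properties.CommutativeSemigroup using (x∙yz≈y∙xz)
open import Data.Bool using (Bool; true; false)
open import Data.Fin using (Fin; zero; suc; combine)
open import Data.Fin.Properties using (combine-injective; combine-surjective; remQuot-combine)
open import Data.Fin.Subset using (Subset; _∈_; _∉_; _⊆_; ∣_∣; inside; outside; _-_; ⁅_⁆)
open import Data.Fin.Subset.Properties using (p─⊥≡p; p─q⊆p)
open import Data.Nat using (ℕ; zero; suc; _+_; _*_; _∸_; _≤_; _<_; z≤n)
open import Data.Nat.Properties
  using (≤-antisym; ≤-trans; ≤∧≢⇒<; +-mono-≤; +-monoˡ-≤; ∸-monoˡ-≤; m≤n+m∸n; +-commutativeSemigroup; module ≤-Reasoning)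
open import Data.Product using (∃-syntax; _×_; _,_; proj₁; proj₂; uncurry)
open import Data.Sum using (_⊎_; inj₁; inj₂)
open import Data.Vec using (Vec; []; _∷_; _++_; concat; lookup; map; replicate; sum; group; here; there)
open import Data.Vec.Properties
  using (lookup-concat; lookup-map; lookup-replicate; map-replicate; map-const; map-∘; map-cong; map-id; []=⇒lookup; lookup⇒[]=)
open import Function using (_∘_; id; const)
open import Relation.Binary.PropositionalEquality
open import Relation.Nullary using (¬_; contradiction)

∣p++q∣≡∣p∣+∣q∣ : ∀ {a b} (p : Subset a) (q : Subset b) → ∣ p ++ q ∣ ≡ ∣ p ∣ + ∣ q ∣
∣p++q∣≡∣p∣+∣q∣ []            q = refl
∣p++q∣≡∣p∣+∣q∣ (inside  ∷ p) q = cong suc (∣p++q∣≡∣p∣+∣q∣ p q)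
∣p++q∣≡∣p∣+∣q∣ (outside ∷ p) q = ∣p++q∣≡∣p∣+∣q∣ p q

∣concat∣≡sum : ∀ {m n} (B : Vec (Subset m) n) → ∣ concat B ∣ ≡ sum (map ∣_∣ B)
∣concat∣≡sum []      = refl
∣concat∣≡sum (p ∷ B) = trans (∣p++q∣≡∣p∣+∣q∣ p (concat B)) (cong (∣ p ∣ +_) (∣concat∣≡sum B))

∈concat⁺ : ∀ {m n} (B : Vec (Subset m) n) {i h} → h ∈ lookup B i → combine i h ∈ concat B
∈concat⁺ B {i} {h} h∈ = lookup⇒[]= (combine i h) (concat B) (trans (lookup-concat B i h) ([]=⇒lookup h∈))

∈concat⁻ : ∀ {m n} (B : Vec (Subset m) n) {i h} → combine i h ∈ concat B → h ∈ lookup B i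
∈concat⁻ B {i} {h} ih∈ = lookup⇒[]= h (lookup B i) (trans (sym (lookup-concat B i h)) ([]=⇒lookup ih∈))

lookup-p-x : ∀ {n} (p : Subset n) x → lookup (p - x) x ≡ outside
lookup-p-x (_ ∷ p) zero    = refl
lookup-p-x (_ ∷ p) (suc x) = lookup-p-x p x

∣p∣≡1+∣p-x∣ : ∀ {n} {p : Subset n} {x} → x ∈ p → ∣ p ∣ ≡ suc ∣ p - x ∣
∣p∣≡1+∣p-x∣ {p = inside  ∷ p} here        = cong (suc ∘ ∣_∣) (sym (p─⊥≡p p))
∣p∣≡1+∣p-x∣ {p = inside  ∷ p} (there x∈p) = cong suc (∣p∣≡1+∣p-x∣ x∈p)
∣p∣≡1+∣p-x∣ {p = outside ∷ p} (there x∈p) = ∣p∣≡1+∣p-x∣ x∈p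

sum-replicate : ∀ n x → sum (replicate n x) ≡ n * x
sum-replicate zero    x = refl
sum-replicate (suc n) x = cong (x +_) (sum-replicate n x)

sum-map-mono-≤ : ∀ {a} {A : Set a} {n} {f g : A → ℕ} (xs : Vec A n) →
                 (∀ i → f (lookup xs i) ≤ g (lookup xs i)) → sum (map f xs) ≤ sum (map g xs)
sum-map-mono-≤ []       f≤g = z≤n
sum-map-mono-≤ (x ∷ xs) f≤g = +-mono-≤ (f≤g zero) (sum-map-mono-≤ xs (f≤g ∘ suc))

sucIf : Bool → ℕ → ℕ
sucIf true  c = suc c
sucIf false c = c

sum-map-sucIf : ∀ {n} c (p : Subset n) → sum (map (λ b → sucIf b c) p) ≡ ∣ p ∣ + n * c
sum-map-sucIf         c []            = refl
sum-map-sucIf {suc n} c (inside  ∷ p) =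
  cong suc (trans (cong (c +_) (sum-map-sucIf c p)) (x∙yz≈y∙xz +-commutativeSemigroup c ∣ p ∣ (n * c)))
sum-map-sucIf {suc n} c (outside ∷ p) =
  trans (cong (c +_) (sum-map-sucIf c p)) (x∙yz≈y∙xz +-commutativeSemigroup c ∣ p ∣ (n * c))

module _ {n} (G : Graph n) where

  ⊆-isPacking : ∀ {P Q} → P ⊆ Q → IsPacking G Q → IsPacking G P
  ⊆-isPacking P⊆Q pk u w u∈ w∈ = pk u w (P⊆Q u∈) (P⊆Q w∈)

  packing-closedNbhd⇒≡ : ∀ {P u w} → IsPacking G P → u ∈ P → w ∈ P → InClosedNbhd G u w → u ≡ w
  packing-closedNbhd⇒≡ pk u∈ w∈ (inj₁ w≡u)  = sym w≡u
  packing-closedNbhd⇒≡ {u = u} {w} pk u∈ w∈ (inj₂ adj) =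
    contradiction (inj₂ adj , inj₁ refl) (pk u w u∈ w∈ u≢w w)
    where
    u≢w : u ≢ w
    u≢w refl = adj-irrefl G adj

  ρ-set-size : ∀ {k P} → IsPackingNumber G k → IsRhoSet G P → ∣ P ∣ ≡ k
  ρ-set-size ((P₀ , pk₀ , ∣P₀∣≡k) , bound) (pk , maximal) =
    ≤-antisym (bound _ pk) (subst (_≤ _) ∣P₀∣≡k (maximal P₀ pk₀))

  maximum-size⇒ρ-set : ∀ {k P} → IsPackingNumber G k → IsPacking G P → ∣ P ∣ ≡ k → IsRhoSet G P
  maximum-size⇒ρ-set (_ , bound) pk ∣P∣≡k = pk , λ Q pk-Q → subst (∣ Q ∣ ≤_) (sym ∣P∣≡k) (bound Q pk-Q)

  forced∉P⇒∣P∣<ρ : ∀ {k P x} → IsPackingNumber G k → (∀ R → IsRhoSet G R → x ∈ R) →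
                   IsPacking G P → x ∉ P → ∣ P ∣ < k
  forced∉P⇒∣P∣<ρ spec forced pk x∉P =
    ≤∧≢⇒< (proj₂ spec _ pk) (λ ∣P∣≡k → x∉P (forced _ (maximum-size⇒ρ-set spec pk ∣P∣≡k)))

module RootedProductPackings {n m} (G : Graph n) (H : Graph m) (v : Fin m) where

  private
    G∘H : Graph (n * m)
    G∘H = RootedProduct G H v

  -- RPAdj decodes both vertices with remQuot, so Adj G∘H x y unfolds to Edge (remQuot m x) (remQuot m y).
  Edge : Fin n × Fin m → Fin n × Fin m → Set
  Edge (i , h) (j , h') = (i ≡ j × Adj H h h') ⊎ (h ≡ v × h' ≡ v × Adj G i j)

  adj⁻ : ∀ {i h j h'} → Adj G∘H (combine i h) (combine j h') → Edge (i , h) (j , h')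
  adj⁻ {i} {h} {j} {h'} = subst₂ Edge (remQuot-combine i h) (remQuot-combine j h')

  adj⁺ : ∀ {i h j h'} → Edge (i , h) (j , h') → Adj G∘H (combine i h) (combine j h')
  adj⁺ {i} {h} {j} {h'} = subst₂ Edge (sym (remQuot-combine i h)) (sym (remQuot-combine j h'))

  InClosedNbhd∘ : Fin n × Fin m → Fin n × Fin m → Set
  InClosedNbhd∘ (i , h) (k , w) = (i ≡ k × InClosedNbhd H h w) ⊎ (h ≡ v × w ≡ v × Adj G i k)

  closedNbhd⁻ : ∀ {i h k w} → InClosedNbhd G∘H (combine i h) (combine k w) → InClosedNbhd∘ (i , h) (k , w)
  closedNbhd⁻ {i} {h} {k} {w} (inj₁ kw≡ih) with combine-injective k w i h kw≡ih
  ... | refl , refl = inj₁ (refl , inj₁ refl)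
  closedNbhd⁻ (inj₂ adj) with adj⁻ adj
  ... | inj₁ (i≡k , adj-H) = inj₁ (i≡k , inj₂ adj-H)
  ... | inj₂ root-edge     = inj₂ root-edge

  closedNbhd⁺ : ∀ {i h k w} → InClosedNbhd∘ (i , h) (k , w) → InClosedNbhd G∘H (combine i h) (combine k w)
  closedNbhd⁺ (inj₁ (refl , inj₁ refl))  = inj₁ refl
  closedNbhd⁺ (inj₁ (refl , inj₂ adj-H)) = inj₂ (adj⁺ (inj₁ (refl , adj-H)))
  closedNbhd⁺ (inj₂ root-edge)           = inj₂ (adj⁺ (inj₂ root-edge))

  IsPacking∘ : Subset (n * m) → Set
  IsPacking∘ Q = ∀ {i h j h' k w} → combine i h ∈ Q → combine j h' ∈ Q → (i , h) ≢ (j , h') →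
    ¬ (InClosedNbhd∘ (i , h) (k , w) × InClosedNbhd∘ (j , h') (k , w))

  isPacking⇒isPacking∘ : ∀ {Q} → IsPacking G∘H Q → IsPacking∘ Q
  isPacking⇒isPacking∘ pk {i} {h} {j} {h'} {k} {w} ih∈ jh'∈ ih≢jh' (near₁ , near₂) =
    pk _ _ ih∈ jh'∈ (ih≢jh' ∘ pair≡) (combine k w) (closedNbhd⁺ near₁ , closedNbhd⁺ near₂)
    where
    pair≡ : combine i h ≡ combine j h' → (i , h) ≡ (j , h')
    pair≡ e with combine-injective i h j h' e
    ... | refl , refl = refl

  isPacking∘⇒isPacking : ∀ {Q} → IsPacking∘ Q → IsPacking G∘H Q
  isPacking∘⇒isPacking separated x y x∈ y∈ x≢y z (near₁ , near₂)
    with combine-surjective {n} {m} x | combine-surjective {n} {m} y | combine-surjective {n} {m} z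
  ... | _ , _ , refl | _ , _ , refl | _ , _ , refl =
    separated x∈ y∈ (x≢y ∘ cong (uncurry combine)) (closedNbhd⁻ near₁ , closedNbhd⁻ near₂)

  rootColumn : Vec (Subset m) n → Subset n
  rootColumn = map (λ b → lookup b v)

  ∈rootColumn⁻ : ∀ (B : Vec (Subset m) n) {i} → i ∈ rootColumn B → v ∈ lookup B i
  ∈rootColumn⁻ B {i} i∈ = lookup⇒[]= v (lookup B i) (trans (sym (lookup-map i _ B)) ([]=⇒lookup i∈))

  ∈rootColumn⁺ : ∀ (B : Vec (Subset m) n) {i} → v ∈ lookup B i → i ∈ rootColumn B
  ∈rootColumn⁺ B {i} v∈ = lookup⇒[]= i (rootColumn B) (trans (lookup-map i _ B) ([]=⇒lookup v∈))

  block-isPacking : ∀ (B : Vec (Subset m) n) {i} → IsPacking G∘H (concat B) → IsPacking H (lookup B i)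
  block-isPacking B pk h h' h∈ h'∈ h≢h' w (near₁ , near₂) =
    isPacking⇒isPacking∘ pk (∈concat⁺ B h∈) (∈concat⁺ B h'∈) (h≢h' ∘ cong proj₂)
      (inj₁ (refl , near₁) , inj₁ (refl , near₂))

  rootColumn-isPacking : ∀ (B : Vec (Subset m) n) → IsPacking G∘H (concat B) → IsPacking G (rootColumn B)
  rootColumn-isPacking B pk i j i∈ j∈ i≢j k (near₁ , near₂) =
    isPacking⇒isPacking∘ pk (∈concat⁺ B (∈rootColumn⁻ B i∈)) (∈concat⁺ B (∈rootColumn⁻ B j∈)) (i≢j ∘ cong proj₁)
      (rootLayer near₁ , rootLayer near₂)
    where
    rootLayer : ∀ {i} → InClosedNbhd G i k → InClosedNbhd∘ (i , v) (k , v)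
    rootLayer (inj₁ refl) = inj₁ (refl , inj₁ refl)
    rootLayer (inj₂ adj)  = inj₂ (refl , refl , adj)

  concat-isPacking : ∀ (B : Vec (Subset m) n) →
    (∀ i → IsPacking H (lookup B i)) → IsPacking G (rootColumn B) →
    (∀ {i j h} → Adj G i j → v ∈ lookup B j → h ∈ lookup B i → ¬ InClosedNbhd H h v) →
    IsPacking G∘H (concat B)
  concat-isPacking B blocks column separated =
    isPacking∘⇒isPacking λ ih∈ jh'∈ → disjointNbhds (∈concat⁻ B ih∈) (∈concat⁻ B jh'∈)
    where
    disjointNbhds : ∀ {i h j h' k w} → h ∈ lookup B i → h' ∈ lookup B j → (i , h) ≢ (j , h') →
      ¬ (InClosedNbhd∘ (i , h) (k , w) × InClosedNbhd∘ (j , h') (k , w))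
    disjointNbhds h∈ h'∈ ih≢jh' (inj₁ (refl , near₁) , inj₁ (refl , near₂)) =
      blocks _ _ _ h∈ h'∈ (ih≢jh' ∘ cong (_ ,_)) _ (near₁ , near₂)
    disjointNbhds h∈ h'∈ ih≢jh' (inj₁ (refl , near₁) , inj₂ (refl , refl , adj)) =
      separated (adj-sym G adj) h'∈ h∈ near₁
    disjointNbhds h∈ h'∈ ih≢jh' (inj₂ (refl , refl , adj) , inj₁ (refl , near₂)) =
      separated (adj-sym G adj) h∈ h'∈ near₂
    disjointNbhds h∈ h'∈ ih≢jh' (inj₂ (refl , refl , adj₁) , inj₂ (refl , _ , adj₂)) =
      column _ _ (∈rootColumn⁺ B h∈) (∈rootColumn⁺ B h'∈) (ih≢jh' ∘ cong (_, v)) _ (inj₂ adj₁ , inj₂ adj₂)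

  ρ-rootAvoidable : ∀ {ρH} → IsPackingNumber H ρH → (∃[ P ] (IsRhoSet H P × v ∉ P)) →
                    IsPackingNumber G∘H (n * ρH)
  ρ-rootAvoidable {ρH} ρH-spec (P , ρ-P@(pk-P , _) , v∉P) = (concat copies , copies-isPacking , size) , upper
    where
    copies : Vec (Subset m) n
    copies = replicate n P

    ∈copy⁻ : ∀ {i h} → h ∈ lookup copies i → h ∈ P
    ∈copy⁻ {i} = subst (_ ∈_) (lookup-replicate i P)

    copies-isPacking : IsPacking G∘H (concat copies)
    copies-isPacking = concat-isPacking copies
      (λ i → ⊆-isPacking H ∈copy⁻ pk-P)
      (λ i _ i∈ _ _ _ _ → v∉P (∈copy⁻ (∈rootColumn⁻ copies i∈)))
      (λ _ v∈ _ _ → v∉P (∈copy⁻ v∈))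

    size : ∣ concat copies ∣ ≡ n * ρH
    size = begin
      ∣ concat copies ∣         ≡⟨ ∣concat∣≡sum copies ⟩
      sum (map ∣_∣ copies)      ≡⟨ cong sum (map-replicate ∣_∣ P n) ⟩
      sum (replicate n ∣ P ∣)   ≡⟨ sum-replicate n ∣ P ∣ ⟩
      n * ∣ P ∣                 ≡⟨ cong (n *_) (ρ-set-size H ρH-spec ρ-P) ⟩
      n * ρH                    ∎
      where open ≡-Reasoning

    upper : ∀ Q → IsPacking G∘H Q → ∣ Q ∣ ≤ n * ρH
    upper Q pk with group n m Q
    ... | B , refl = begin
      ∣ concat B ∣                ≡⟨ ∣concat∣≡sum B ⟩
      sum (map ∣_∣ B)             ≤⟨ sum-map-mono-≤ B (λ i → proj₂ ρH-spec _ (block-isPacking B pk)) ⟩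
      sum (map (const ρH) B)      ≡⟨ cong sum (map-const B ρH) ⟩
      sum (replicate n ρH)        ≡⟨ sum-replicate n ρH ⟩
      n * ρH                      ∎
      where open ≤-Reasoning

  ρ-rootForced : ∀ {ρG ρH} → IsPackingNumber G ρG → IsPackingNumber H ρH → (∀ P → IsRhoSet H P → v ∈ P) →
                 IsPackingNumber G∘H (ρG + n * (ρH ∸ 1))
  ρ-rootForced {ρG} {ρH} ((S , pk-S , ∣S∣≡ρG) , ρG-max) ρH-spec@((P , pk-P , ∣P∣≡ρH) , _) forced =
    (concat B , B-isPacking , size) , upper
    where
    v∈P : v ∈ P
    v∈P = forced P (maximum-size⇒ρ-set H ρH-spec pk-P ∣P∣≡ρH)

    ∣P-v∣≡ρH∸1 : ∣ P - v ∣ ≡ ρH ∸ 1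
    ∣P-v∣≡ρH∸1 = cong (_∸ 1) (trans (sym (∣p∣≡1+∣p-x∣ v∈P)) ∣P∣≡ρH)

    layer : Bool → Subset m
    layer true  = P
    layer false = P - v

    B : Vec (Subset m) n
    B = map layer S

    ∈B⇒∈P : ∀ {i h} → h ∈ lookup B i → h ∈ P
    ∈B⇒∈P {i} {h} h∈ with lookup S i | subst (h ∈_) (lookup-map i layer S) h∈
    ... | true  | h∈P   = h∈P
    ... | false | h∈P-v = p─q⊆p P ⁅ v ⁆ h∈P-v

    lookup-layer-v : ∀ b → lookup (layer b) v ≡ b
    lookup-layer-v true  = []=⇒lookup v∈P
    lookup-layer-v false = lookup-p-x P v

    rootColumn-B : rootColumn B ≡ S
    rootColumn-B = begin
      map (λ b → lookup b v) (map layer S)  ≡⟨ map-∘ (λ b → lookup b v) layer S ⟨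
      map (λ b → lookup (layer b) v) S      ≡⟨ map-cong lookup-layer-v S ⟩
      map id S                              ≡⟨ map-id S ⟩
      S                                     ∎
      where open ≡-Reasoning

    ∈S⁺ : ∀ {i} → v ∈ lookup B i → i ∈ S
    ∈S⁺ v∈ = subst (_ ∈_) rootColumn-B (∈rootColumn⁺ B v∈)

    -- a vertex of B i next to v is v itself, so then both i and j lie in the packing S
    separated : ∀ {i j h} → Adj G i j → v ∈ lookup B j → h ∈ lookup B i → ¬ InClosedNbhd H h v
    separated {i} adj v∈Bj h∈Bi h~v with packing-closedNbhd⇒≡ H pk-P (∈B⇒∈P h∈Bi) v∈P h~v
    ... | refl with packing-closedNbhd⇒≡ G pk-S (∈S⁺ {i} h∈Bi) (∈S⁺ v∈Bj) (inj₂ adj)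
    ...   | refl = adj-irrefl G adj

    B-isPacking : IsPacking G∘H (concat B)
    B-isPacking = concat-isPacking B (λ i → ⊆-isPacking H ∈B⇒∈P pk-P)
      (subst (IsPacking G) (sym rootColumn-B) pk-S) separated

    ∣layer∣ : ∀ b → ∣ layer b ∣ ≡ sucIf b (ρH ∸ 1)
    ∣layer∣ true  = trans (∣p∣≡1+∣p-x∣ v∈P) (cong suc ∣P-v∣≡ρH∸1)
    ∣layer∣ false = ∣P-v∣≡ρH∸1

    size : ∣ concat B ∣ ≡ ρG + n * (ρH ∸ 1)
    size = begin
      ∣ concat B ∣                                ≡⟨ ∣concat∣≡sum B ⟩
      sum (map ∣_∣ (map layer S))                 ≡⟨ cong sum (map-∘ ∣_∣ layer S) ⟨
      sum (map (∣_∣ ∘ layer) S)                   ≡⟨ cong sum (map-cong ∣layer∣ S) ⟩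
      sum (map (λ b → sucIf b (ρH ∸ 1)) S)        ≡⟨ sum-map-sucIf (ρH ∸ 1) S ⟩
      ∣ S ∣ + n * (ρH ∸ 1)                        ≡⟨ cong (_+ n * (ρH ∸ 1)) ∣S∣≡ρG ⟩
      ρG + n * (ρH ∸ 1)                           ∎
      where open ≡-Reasoning

    block-bound : ∀ {b} → IsPacking H b → ∣ b ∣ ≤ sucIf (lookup b v) (ρH ∸ 1)
    block-bound {b} pk-b with lookup b v in lookup≡
    ... | true  = ≤-trans (proj₂ ρH-spec b pk-b) (m≤n+m∸n ρH 1)
    ... | false = ∸-monoˡ-≤ 1 (forced∉P⇒∣P∣<ρ H ρH-spec forced pk-b v∉b)
      where
      v∉b : v ∉ b
      v∉b v∈b = contradiction (trans (sym lookup≡) ([]=⇒lookup v∈b)) λ ()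

    upper : ∀ Q → IsPacking G∘H Q → ∣ Q ∣ ≤ ρG + n * (ρH ∸ 1)
    upper Q pk with group n m Q
    ... | B′ , refl = begin
      ∣ concat B′ ∣                                                ≡⟨ ∣concat∣≡sum B′ ⟩
      sum (map ∣_∣ B′)                                             ≤⟨ sum-map-mono-≤ B′ (λ i → block-bound (block-isPacking B′ pk)) ⟩
      sum (map (λ b → sucIf (lookup b v) (ρH ∸ 1)) B′)             ≡⟨ cong sum (map-∘ (λ b → sucIf b (ρH ∸ 1)) (λ b → lookup b v) B′) ⟩
      sum (map (λ b → sucIf b (ρH ∸ 1)) (rootColumn B′))           ≡⟨ sum-map-sucIf (ρH ∸ 1) (rootColumn B′) ⟩
      ∣ rootColumn B′ ∣ + n * (ρH ∸ 1)                             ≤⟨ +-monoˡ-≤ (n * (ρH ∸ 1)) (ρG-max _ (rootColumn-isPacking B′ pk)) ⟩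
      ρG + n * (ρH ∸ 1)                                            ∎
      where open ≤-Reasoning

open RootedProductPackings using (ρ-rootForced; ρ-rootAvoidable)

theorem14 : ∀ {n m} (G : Graph n) (H : Graph m) (v : Fin m) (ρG ρH : ℕ) →
    IsPackingNumber G ρG → IsPackingNumber H ρH →
    ((∀ P → IsRhoSet H P → v ∈ P) →
      IsPackingNumber (RootedProduct G H v) (ρG + n * (ρH ∸ 1)))
    × ((∃[ P ] (IsRhoSet H P × v ∉ P)) →
      IsPackingNumber (RootedProduct G H v) (n * ρH))
theorem14 G H v ρG ρH ρG-spec ρH-spec =
  ρ-rootForced G H v ρG-spec ρH-spec , ρ-rootAvoidable G H v ρH-spec
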